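{- For all positive integers $n$ and $r$ with $r \geq 3$, let $\mathcal{K}^r_{N_r}$ be the ordered complete $r$-uniform hypergraph with vertex set $F_r(n)$ ordered by $<_r$, colored by $c_r$. Then there is no monochromatic copy of $\mathcal{P}^r_{2n+r-1}$ in it; that is, there are no $A_1<_r\dots<_r A_{2n+r-1}$ in $F_r(n)$ such that all edges $\{A_i,\dots,A_{i+r-1}\}$, $1\le i\le 2n$, receive the same color under $c_r$.
   Context: Fix a positive integer $n$. Level 1: $F_1^-(n)=\{ -\}$, $F_1^+(n)=\{+\}$, $F_1(n)=\{ -,+\}$, $-<_1+$, and $-\equiv_1+$. Level 2: $F_2^-(n)=\{(2n-i+1,i): i\in[n]\}$, $F_2^+(n)=\{(i,2n-i+1): i\in[n]\}$, $F_2(n)=F_2^-(n)\cup F_2^+(n)$, with total order $(2n,1)<_2(2n-1,2)<_2\dots<_2(1,2n)$, and $(2n-i+1,i)\equiv_2(i,2n-i+1)$. For $r\ge 2$, each $\equiv_r$-class consists of one element of $F_r^-(n)$ and its equivalent partner in $F_r^+(n)$ (or just itself); for $A\in F_r(n)$ let $A^-$ denote the unique element of $F_r^-(n)$ equivalent to $A$, and define the preorder $\preceq_r$ on $F_r(n)$ (a linear order on $\equiv_r$-classes) by $A\preceq_r B$ iff $A^-\le_r B^-$, with $A\prec_r B$ iff $A^-<_r B^-$. For distinct $A=(a_1,a_2),B=(b_1,b_2)\in F_2(n)$, $\gamma(A,B)=-$ if $a_1<b_1$ and $\gamma(A,B)=+$ if $a_1>b_1$. For $r\ge 3$: $F_r(n)$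 is the family of all sets $X\subseteq F_{r-1}(n)$ containing exactly one element from each $\equiv_{r-1}$-class; $F_r^-(n)$ (type $-$) consists of those $X$ containing the $<_{r-1}$-minimum of $F_{r-1}(n)$ and $F_r^+(n)$ (type $+$) of those containing the $<_{r-1}$-maximum. For distinct $A,B\in F_r(n)$, let $E$ be the $\prec_{r-1}$-first $\equiv_{r-1}$-class on which $A$ and $B$ differ, and let $\gamma(A,B)$ be the element of $B\cap E$. Define $A<_r B$ iff $\gamma(A,B)\in F_{r-1}^+(n)$ (a total order). For $X\in F_r^-(n)$ let $\sigma_r(X)\in F_r^+(n)$ be obtained by replacing every element of $X$ by the other element of its $\equiv_{r-1}$-class, and let $A\equiv_r B$ iff $A=B$, $A=\sigma_r(B)$ or $B=\sigma_r(A)$. Let $N_r=|F_r(n)|$. For a sequence $(B_1,\dots,B_k)$ in $F_r(n)$ with consecutive terms distinct, $\Gamma(B_1,\dots,B_k)=(\gamma(B_1,B_2),\dots,\gamma(B_{k-1},B_k))$, a sequence in $F_{r-1}(n)$; $\Gamma^0$ is the identity and $\Gamma^i=\Gamma\circ\Gamma^{i-1}$. The coloring $c_r$ assigns to each $r$-set $\{A_1,\dots,A_r\}\subseteq F_r(n)$ with $A_1<_r\dots<_r A_r$ the value $\Gamma^{r-1}(A_1,\dots,A_r)\in\{ -,+\}$. -}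

module Defs where

open import Data.Nat using (ℕ; zero; suc; _+_; _*_; _∸_; _≡ᵇ_; _<ᵇ_; pred)
open import Data.Bool using (Bool; true; false; _∧_; if_then_else_)
open import Data.List using (List; []; _∷_; map; _++_; upTo; concatMap; zipWith; filterᵇ)
open import Data.Bool.ListAction using (any)
open import Data.Maybe using (Maybe; just; nothing; maybe; _>>=_)

data Sign : Set where
  minus plus : Sign

-- Universe of objects: elements of F₁ (signs), of F₂ (pairs of naturals),
-- and of F_r for r ≥ 3 (sets of elements of F_{r-1}).  A set X ∈ F_r(n)
-- (r ≥ 3) contains exactly one element of each ≡_{r-1}-class, and is
-- represented canonically by the list of its elements listed in the
-- ≼_{r-1}-order of those classes (so sets are equal iff lists are equal).
data Obj : Set where
  sg : Sign → Obj
  pr : ℕ → ℕ → Obj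
  st : List Obj → Obj

mutual
  eqObj : Obj → Obj → Bool
  eqObj (sg minus) (sg minus) = true
  eqObj (sg plus) (sg plus) = true
  eqObj (pr a b) (pr c d) = (a ≡ᵇ c) ∧ (b ≡ᵇ d)
  eqObj (st xs) (st ys) = eqList xs ys
  eqObj _ _ = false

  eqList : List Obj → List Obj → Bool
  eqList [] [] = true
  eqList (x ∷ xs) (y ∷ ys) = eqObj x y ∧ eqList xs ys
  eqList _ _ = false

firstDiff : List Obj → List Obj → Maybe Obj
firstDiff (x ∷ xs) (y ∷ ys) = if eqObj x y then firstDiff xs ys else just y
firstDiff _ _ = nothing

choices : {A : Set} → List (List A) → List (List A)
choices [] = [] ∷ []
choices (c ∷ cs) = concatMap (λ x → map (x ∷_) (choices cs)) c

insertBy : {A : Set} → (A → A → Bool) → A → List A → List A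
insertBy lt x [] = x ∷ []
insertBy lt x (y ∷ ys) = if lt y x then y ∷ insertBy lt x ys else x ∷ y ∷ ys

sortBy : {A : Set} → (A → A → Bool) → List A → List A
sortBy lt [] = []
sortBy lt (x ∷ xs) = insertBy lt x (sortBy lt xs)

minBy : {A : Set} → (A → A → Bool) → List A → Maybe A
minBy lt [] = nothing
minBy lt (x ∷ xs) with minBy lt xs
... | nothing = just x
... | just m = if lt m x then just m else just x

maxBy : {A : Set} → (A → A → Bool) → List A → Maybe A
maxBy lt [] = nothing
maxBy lt (x ∷ xs) with maxBy lt xs
... | nothing = just x
... | just m = if lt x m then just m else just x

other : List Obj → Obj → Obj
other (a ∷ b ∷ []) x = if eqObj x a then b else a
other _ x = x

range : ℕ → List ℕ
range n = map suc (upTo n)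

mutual
  F : ℕ → ℕ → List Obj
  F zero n = []
  F 1 n = sg minus ∷ sg plus ∷ []
  F 2 n = map (λ i → pr (2 * n ∸ i + 1) i) (range n)
          ++ map (λ i → pr i (2 * n ∸ i + 1)) (range n)
  F (suc r@(suc (suc k))) n = map st (choices (classes r n))

  -- classes r n : the ≡_r-classes of F_r(n), listed in ≼_r-order
  -- (each class listed as  A⁻ ∷ partner ∷ [] )
  classes : ℕ → ℕ → List (List Obj)
  classes zero n = []
  classes 1 n = (sg minus ∷ sg plus ∷ []) ∷ []
  classes 2 n = map (λ i → pr (2 * n ∸ i + 1) i ∷ pr i (2 * n ∸ i + 1) ∷ []) (range n)
  classes (suc r@(suc (suc k))) n =
    map (λ X → X ∷ sigma r n X ∷ [])
        (sortBy (lt (suc r) n) (filterᵇ (isMinus (suc r) n) (F (suc r) n)))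

  sigma : ℕ → ℕ → Obj → Obj
  sigma r n (st xs) = st (zipWith other (classes r n) xs)
  sigma r n X = X

  lt : ℕ → ℕ → Obj → Obj → Bool
  lt zero n _ _ = false
  lt 1 n (sg minus) (sg plus) = true
  lt 1 n _ _ = false
  lt 2 n (pr a _) (pr b _) = b <ᵇ a
  lt 2 n _ _ = false
  lt (suc r@(suc (suc k))) n (st xs) (st ys) = maybe (isPlus r n) false (firstDiff xs ys)
  lt (suc r@(suc (suc k))) n _ _ = false

  isMinus : ℕ → ℕ → Obj → Bool
  isMinus 1 n (sg minus) = true
  isMinus 2 n (pr a b) = b <ᵇ a
  isMinus (suc r@(suc (suc k))) n (st xs) =
    maybe (λ m → any (eqObj m) xs) false (minBy (lt r n) (F r n))
  isMinus _ n _ = false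

  isPlus : ℕ → ℕ → Obj → Bool
  isPlus 1 n (sg plus) = true
  isPlus 2 n (pr a b) = a <ᵇ b
  isPlus (suc r@(suc (suc k))) n (st xs) =
    maybe (λ m → any (eqObj m) xs) false (maxBy (lt r n) (F r n))
  isPlus _ n _ = false

-- γ(A,B) for A, B ∈ F_r(n), r ≥ 2 (nothing if undefined, e.g. A = B)
gamma : ℕ → ℕ → Obj → Obj → Maybe Obj
gamma 2 n (pr a _) (pr b _) =
  if a <ᵇ b then just (sg minus) else (if b <ᵇ a then just (sg plus) else nothing)
gamma (suc (suc (suc k))) n (st xs) (st ys) = firstDiff xs ys
gamma _ n _ _ = nothing

Γ : ℕ → ℕ → List Obj → Maybe (List Obj)
Γ r n (a ∷ b ∷ rest) =
  gamma r n a b >>= λ g → Γ r n (b ∷ rest) >>= λ gs → just (g ∷ gs)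
Γ r n _ = just []

Γiter : ℕ → ℕ → ℕ → List Obj → Maybe (List Obj)
Γiter n zero r xs = just xs
Γiter n (suc i) r xs = Γ r n xs >>= Γiter n i (pred r)

signOf : List Obj → Maybe Sign
signOf (sg s ∷ []) = just s
signOf _ = nothing

-- c_r of the r-set {A₁ <_r … <_r A_r}, given as the increasing list
colour : ℕ → ℕ → List Obj → Maybe Sign
colour r n xs = Γiter n (r ∸ 1) r xs >>= signOf

-- Γ commutes with taking windows, so Γ maps the 2n + r − 1 vertices of a monochromatic
-- tight path in F_r(n) to the 2n + r − 2 vertices of a monochromatic tight path in
-- F_{r−1}(n): the colour of an edge is by definition the colour of its Γ-image. After r − 2
-- steps we reach 2n + 1 elements of F₂(n) whose consecutive γ-values all agree, i.e. whose
-- first coordinates form a strictly monotone sequence of length 2n + 1 in [1, 2n].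
module Submission where

open import Defs
open import Data.Nat using (ℕ; _+_; _*_; _∸_; _≤_; _<_)
open import Data.Bool using (true)
open import Data.List using (List; length; take; drop)
open import Data.List.Membership.Propositional using (_∈_)
open import Data.List.Relation.Unary.All using (All)
open import Data.List.Relation.Unary.Linked using (Linked)
open import Data.Maybe using (just)
open import Data.Product using (Σ)
open import Relation.Nullary using (¬_)
open import Relation.Binary.PropositionalEquality using (_≡_)

open import Data.Nat using (zero; suc; _>_; _<ᵇ_; z≤n; s≤s; z<s; s<s)
open import Data.Nat.Properties
  using (≤-trans; ≤-reflexive; <-≤-trans; +-suc; +-identityʳ; +-monoˡ-≤; +-monoʳ-≤; +-∸-assoc;
         m∸n+n≡m; m≤n+m; m≤n*m; m+1+n≰m; suc-injective; <ᵇ⇒<; module ≤-Reasoning)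
open import Data.Bool using (Bool; false; T; T?)
open import Data.List using ([]; _∷_; map; zipWith; filterᵇ)
open import Data.List.Properties using (take-all; take-[]; drop-[]; length-map)
open import Data.List.Membership.Propositional using (find; lose)
open import Data.List.Membership.Propositional.Properties
  using (∈-map⁺; ∈-map⁻; ∈-++⁺ˡ; ∈-++⁺ʳ; ∈-++⁻; ∈-concatMap⁺; ∈-concatMap⁻; ∈-filter⁻; ∈-upTo⁻)
open import Data.List.Relation.Unary.All using ([]; _∷_; unzip)
import Data.List.Relation.Unary.All as All
import Data.List.Relation.Unary.All.Properties as All
open import Data.List.Relation.Unary.Any using (here; there)
open import Data.List.Relation.Unary.Linked using ([]; [-]; _∷_)
import Data.List.Relation.Unary.Linked.Properties as Linked
open import Data.List.Relation.Binary.Pointwise using (Pointwise; []; _∷_)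
open import Data.Maybe using (nothing)
open import Data.Product using (_,_; _×_; ∃; ∃₂; proj₁)
open import Data.Sum using (_⊎_; inj₁; inj₂; map₂)
open import Data.Empty using (⊥)
open import Function using (_on_; _∘_)
open import Relation.Binary.PropositionalEquality using (refl; sym; trans; cong; subst)

module _ {r n : ℕ} where

  Γ-∷⁺ : ∀ {a b rest g gs} → gamma r n a b ≡ just g → Γ r n (b ∷ rest) ≡ just gs →
         Γ r n (a ∷ b ∷ rest) ≡ just (g ∷ gs)
  Γ-∷⁺ eg egs rewrite eg | egs = refl

  Γ-∷⁻ : ∀ a b rest {zs} → Γ r n (a ∷ b ∷ rest) ≡ just zs →
         ∃₂ λ g gs → zs ≡ g ∷ gs × gamma r n a b ≡ just g × Γ r n (b ∷ rest) ≡ just gs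
  Γ-∷⁻ a b rest eq with gamma r n a b | Γ r n (b ∷ rest)
  ... | just g  | just gs with refl ← eq = g , gs , refl , refl , refl
  ... | just _  | nothing with () ← eq
  ... | nothing | _       with () ← eq

  Γ-length : ∀ {L L'} → Γ r n L ≡ just L' → length L' ≡ length L ∸ 1
  Γ-length {[]}     refl = refl
  Γ-length {_ ∷ []} refl = refl
  Γ-length {a ∷ b ∷ rest} eq with Γ-∷⁻ a b rest eq
  ... | _ , _ , refl , _ , egs = cong suc (Γ-length {b ∷ rest} egs)

  Γ-length-+ : ∀ L {L'} m k → length L ≡ m + suc k → Γ r n L ≡ just L' → length L' ≡ m + k
  Γ-length-+ L m k len eq =
    trans (Γ-length {L} eq) (trans (cong (_∸ 1) len) (+-∸-assoc m (s≤s z≤n)))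

  Γ-drop : ∀ i {L L'} → Γ r n L ≡ just L' → Γ r n (drop i L) ≡ just (drop i L')
  Γ-drop zero    eq = eq
  Γ-drop (suc i) {[]}     refl = refl
  Γ-drop (suc i) {_ ∷ []} refl rewrite drop-[] {A = Obj} i = refl
  Γ-drop (suc i) {a ∷ b ∷ rest} eq with Γ-∷⁻ a b rest eq
  ... | _ , _ , refl , _ , egs = Γ-drop i {b ∷ rest} egs

  Γ-take : ∀ j {L L'} → Γ r n L ≡ just L' → Γ r n (take (suc j) L) ≡ just (take j L')
  Γ-take j       {[]}     refl rewrite take-[] {A = Obj} j = refl
  Γ-take zero    {_ ∷ _}  _    = refl
  Γ-take (suc j) {_ ∷ []} refl = refl
  Γ-take (suc j) {a ∷ b ∷ rest} eq with Γ-∷⁻ a b rest eq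
  ... | _ , _ , refl , eg , egs = Γ-∷⁺ {rest = take j rest} eg (Γ-take j {b ∷ rest} egs)

  Γ-window : ∀ i j {L L'} → Γ r n L ≡ just L' →
             Γ r n (take (suc j) (drop i L)) ≡ just (take j (drop i L'))
  Γ-window i j {L} eq = Γ-take j {drop i L} (Γ-drop i eq)

  Γ-defined-from-windows : ∀ m j L → length L ≡ suc m + suc j →
    (∀ i → i < suc m → ∃ λ W → Γ r n (take (suc (suc j)) (drop i L)) ≡ just W) →
    ∃ λ L' → Γ r n L ≡ just L'
  Γ-defined-from-windows zero j L len defined =
    subst (λ xs → ∃ λ L' → Γ r n xs ≡ just L') (take-all (suc (suc j)) L (≤-reflexive len))
          (defined 0 z<s)
  Γ-defined-from-windows (suc m) j (a ∷ b ∷ rest) len defined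
    with defined 0 z<s
  ... | _ , eqW with Γ-∷⁻ a b (take j rest) eqW
  ... | g , _ , _ , eg , _ with Γ-defined-from-windows m j (b ∷ rest) (suc-injective len)
                                   (λ i i<m → defined (suc i) (s<s i<m))
  ... | gs , egs = g ∷ gs , Γ-∷⁺ {rest = rest} eg egs

MonochromaticWindows : ℕ → ℕ → Sign → ℕ → List Obj → Set
MonochromaticWindows r n s m L = ∀ i → i < m → colour r n (take r (drop i L)) ≡ just s

colour-Γ : ∀ r n xs {ys} → Γ (suc (suc r)) n xs ≡ just ys →
           colour (suc (suc r)) n xs ≡ colour (suc r) n ys
colour-Γ r n xs eq rewrite eq = refl

colour-defined⇒Γ-defined : ∀ r n xs {s} → colour (suc (suc r)) n xs ≡ just s →
                           ∃ λ ys → Γ (suc (suc r)) n xs ≡ just ys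
colour-defined⇒Γ-defined r n xs eq with Γ (suc (suc r)) n xs
... | just ys = ys , refl

Γ-monochromatic : ∀ r n s m L → 0 < m → length L ≡ m + suc r →
  MonochromaticWindows (suc (suc r)) n s m L →
  ∃ λ L' → Γ (suc (suc r)) n L ≡ just L' × length L' ≡ m + r ×
           MonochromaticWindows (suc r) n s m L'
Γ-monochromatic r n s (suc m) L _ len mono with
  Γ-defined-from-windows {n = n} m r L len
    (λ i i<m → colour-defined⇒Γ-defined r n (take (suc (suc r)) (drop i L)) (mono i i<m))
... | L' , eq = L' , eq , Γ-length-+ {n = n} L (suc m) r len eq , λ i i<m →
  trans (sym (colour-Γ r n (take (suc (suc r)) (drop i L)) (Γ-window {n = n} i (suc r) {L} eq)))
        (mono i i<m)

∈-choices⁻ : ∀ {A : Set} (cs : List (List A)) {ys} → ys ∈ choices cs → Pointwise _∈_ ys cs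
∈-choices⁻ []       (here refl) = []
∈-choices⁻ (c ∷ cs) p with find (∈-concatMap⁻ (λ x → map (x ∷_) (choices cs)) {xs = c} p)
... | x , x∈c , q with ∈-map⁻ (x ∷_) q
... | zs , zs∈ , refl = x∈c ∷ ∈-choices⁻ cs zs∈

∈-choices⁺ : ∀ {A : Set} {cs : List (List A)} {ys} → Pointwise _∈_ ys cs → ys ∈ choices cs
∈-choices⁺ []                     = here refl
∈-choices⁺ {cs = _ ∷ cs} (x∈c ∷ ps) =
  ∈-concatMap⁺ (λ x → map (x ∷_) (choices cs)) (lose x∈c (∈-map⁺ _ (∈-choices⁺ ps)))

Pointwise-∈ : ∀ {A : Set} {ys : List A} {cs g} → Pointwise _∈_ ys cs → g ∈ ys →
              ∃ λ c → c ∈ cs × g ∈ c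
Pointwise-∈ (g∈c ∷ _)  (here refl) = _ , here refl , g∈c
Pointwise-∈ (_   ∷ ps) (there g∈)  with Pointwise-∈ ps g∈
... | c , c∈ , g∈c = c , there c∈ , g∈c

∈-other : ∀ c {x} → x ∈ c → other c x ∈ c
∈-other (a ∷ b ∷ []) {x} _ with eqObj x a
... | true  = there (here refl)
... | false = here refl
∈-other []               x∈ = x∈
∈-other (_ ∷ [])         x∈ = x∈
∈-other (_ ∷ _ ∷ _ ∷ _)  x∈ = x∈

Pointwise-other : ∀ {xs cs} → Pointwise _∈_ xs cs → Pointwise _∈_ (zipWith other cs xs) cs
Pointwise-other []                       = []
Pointwise-other {cs = c ∷ _} (x∈c ∷ ps) = ∈-other c x∈c ∷ Pointwise-other ps

∈-firstDiff : ∀ xs ys {g} → firstDiff xs ys ≡ just g → g ∈ ys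
∈-firstDiff (x ∷ xs) (y ∷ ys) eq with eqObj x y
... | true = there (∈-firstDiff xs ys eq)
∈-firstDiff (x ∷ xs) (y ∷ ys) refl | false = here refl

∈-insertBy⁻ : ∀ {A : Set} (lt : A → A → Bool) x ys {y} → y ∈ insertBy lt x ys → y ≡ x ⊎ y ∈ ys
∈-insertBy⁻ lt x []       (here eq) = inj₁ eq
∈-insertBy⁻ lt x (z ∷ ys) p with lt z x | p
... | true  | here eq = inj₂ (here eq)
... | true  | there q = map₂ there (∈-insertBy⁻ lt x ys q)
... | false | here eq = inj₁ eq
... | false | there q = inj₂ q

∈-sortBy⁻ : ∀ {A : Set} (lt : A → A → Bool) xs {y} → y ∈ sortBy lt xs → y ∈ xs
∈-sortBy⁻ lt (x ∷ xs) p with ∈-insertBy⁻ lt x (sortBy lt xs) p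
... | inj₁ eq = here eq
... | inj₂ q  = there (∈-sortBy⁻ lt xs q)

∈-sortBy-filterᵇ⁻ : ∀ {A : Set} (lt : A → A → Bool) p xs {y} →
                    y ∈ sortBy lt (filterᵇ p xs) → y ∈ xs
∈-sortBy-filterᵇ⁻ lt p xs y∈ =
  proj₁ (∈-filter⁻ (T? ∘ p) {xs = xs} (∈-sortBy⁻ lt (filterᵇ p xs) y∈))

∈-classes : ∀ t n {c g} → c ∈ classes (suc (suc t)) n → g ∈ c → g ∈ F (suc (suc t)) n
∈-classes zero n c∈ g∈c with ∈-map⁻ (λ i → pr (2 * n ∸ i + 1) i ∷ pr i (2 * n ∸ i + 1) ∷ []) c∈
... | i , i∈ , refl with g∈c
...   | here refl         = ∈-++⁺ˡ (∈-map⁺ (λ i → pr (2 * n ∸ i + 1) i) i∈)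
...   | there (here refl) = ∈-++⁺ʳ (map (λ i → pr (2 * n ∸ i + 1) i) (range n))
                                   (∈-map⁺ (λ i → pr i (2 * n ∸ i + 1)) i∈)
∈-classes (suc t) n c∈ g∈c with ∈-map⁻ (λ X → X ∷ sigma (suc (suc t)) n X ∷ []) c∈
... | X , X∈ , refl with ∈-sortBy-filterᵇ⁻ (lt (suc (suc (suc t))) n) (isMinus (suc (suc (suc t))) n)
                           (F (suc (suc (suc t))) n) X∈
...   | X∈F with g∈c
...     | here refl         = X∈F
...     | there (here refl) with ∈-map⁻ st X∈F
...       | xs , xs∈ , refl = ∈-map⁺ st (∈-choices⁺ (Pointwise-other (∈-choices⁻ _ xs∈)))

gamma-∈ : ∀ t n a {b g} → b ∈ F (suc (suc (suc t))) n →
          gamma (suc (suc (suc t))) n a b ≡ just g → g ∈ F (suc (suc t)) n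
gamma-∈ t n a b∈ eq with ∈-map⁻ st b∈
gamma-∈ t n (st xs) b∈ eq | ys , ys∈ , refl
  with Pointwise-∈ (∈-choices⁻ _ ys∈) (∈-firstDiff xs ys eq)
... | c , c∈ , g∈c = ∈-classes t n c∈ g∈c

Γ-∈ : ∀ t n L {L'} → Γ (suc (suc (suc t))) n L ≡ just L' →
      All (_∈ F (suc (suc (suc t))) n) L → All (_∈ F (suc (suc t)) n) L'
Γ-∈ t n []           refl _ = []
Γ-∈ t n (_ ∷ [])     refl _ = []
Γ-∈ t n (a ∷ b ∷ rest) eq (_ ∷ b∈ ∷ mem) with Γ-∷⁻ {suc (suc (suc t))} {n} a b rest eq
... | _ , _ , refl , eg , egs = gamma-∈ t n a b∈ eg ∷ Γ-∈ t n (b ∷ rest) egs (b∈ ∷ mem)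

first : Obj → ℕ
first (pr a _) = a
first _        = 0

∈-range⁻ : ∀ {n i} → i ∈ range n → 1 ≤ i × i ≤ n
∈-range⁻ i∈ with ∈-map⁻ suc i∈
... | _ , j∈ , refl = s≤s z≤n , ∈-upTo⁻ j∈

F₂-first-bounds : ∀ n {x} → x ∈ F 2 n → 1 ≤ first x × first x ≤ 2 * n
F₂-first-bounds n x∈ with ∈-++⁻ (map (λ i → pr (2 * n ∸ i + 1) i) (range n)) x∈
... | inj₁ p with ∈-map⁻ (λ i → pr (2 * n ∸ i + 1) i) p
...   | i , i∈ , refl with ∈-range⁻ i∈
...     | 1≤i , i≤n = m≤n+m 1 _ , ≤-trans (+-monoʳ-≤ (2 * n ∸ i) 1≤i)
                                          (≤-reflexive (m∸n+n≡m (≤-trans i≤n (m≤n*m n 2))))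
F₂-first-bounds n x∈ | inj₂ p with ∈-map⁻ (λ i → pr i (2 * n ∸ i + 1)) p
...   | i , i∈ , refl with ∈-range⁻ i∈
...     | 1≤i , i≤n = 1≤i , ≤-trans i≤n (m≤n*m n 2)

Ascends : Sign → ℕ → ℕ → Set
Ascends minus a b = a < b
Ascends plus  a b = b < a

gamma₂-ascends : ∀ n s x y → gamma 2 n x y ≡ just (sg s) → Ascends s (first x) (first y)
gamma₂-ascends n s (pr a _) (pr b _) eq with a <ᵇ b in a<b
... | true with refl ← eq = <ᵇ⇒< a b (subst T (sym a<b) _)
... | false with b <ᵇ a in b<a
...   | true with refl ← eq = <ᵇ⇒< b a (subst T (sym b<a) _)

Γ₂-ascends : ∀ n s L {L'} → Γ 2 n L ≡ just L' → All (_≡ sg s) L' → Linked (Ascends s on first) L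
Γ₂-ascends n s []       _ _ = []
Γ₂-ascends n s (_ ∷ []) _ _ = [-]
Γ₂-ascends n s (a ∷ b ∷ rest) eq signs with Γ-∷⁻ {2} {n} a b rest eq
... | _ , _ , refl , eg , egs with signs
...   | refl ∷ signs′ = gamma₂-ascends n s a b eg ∷ Γ₂-ascends n s (b ∷ rest) egs signs′

increasing-bound : ∀ {B x xs} → Linked _<_ (x ∷ xs) → All (_≤ B) (x ∷ xs) → x + length xs ≤ B
increasing-bound {x = x} {[]}     _         (x≤B ∷ _) = ≤-trans (≤-reflexive (+-identityʳ x)) x≤B
increasing-bound {x = x} {_ ∷ ys} (x<y ∷ l) (_ ∷ bs)  =
  ≤-trans (≤-reflexive (+-suc x (length ys)))
          (≤-trans (+-monoˡ-≤ (length ys) x<y) (increasing-bound l bs))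

decreasing-bound : ∀ {x xs} → Linked _>_ (x ∷ xs) → All (1 ≤_) (x ∷ xs) → length xs < x
decreasing-bound {xs = []}    _         (1≤x ∷ _) = 1≤x
decreasing-bound {xs = _ ∷ _} (x>y ∷ l) (_ ∷ bs)  = <-≤-trans (s≤s (decreasing-bound l bs)) x>y

strictly-monotone-length : ∀ s {B xs} → Linked (Ascends s) xs → All (λ a → 1 ≤ a × a ≤ B) xs →
                           length xs ≤ B
strictly-monotone-length s     {xs = []}    _ _ = z≤n
strictly-monotone-length minus {xs = _ ∷ _} l bounds with unzip bounds
... | 1≤x ∷ _ , ≤B = ≤-trans (+-monoˡ-≤ _ 1≤x) (increasing-bound l ≤B)
strictly-monotone-length plus  {xs = _ ∷ _} l bounds with unzip bounds
... | 1≤ , x≤B ∷ _ = ≤-trans (decreasing-bound l 1≤) x≤B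

signs-from-windows : ∀ n s m xs → length xs ≡ m → MonochromaticWindows 1 n s m xs →
                     All (_≡ sg s) xs
signs-from-windows n s _ []           _    _    = []
signs-from-windows n s _ (sg _ ∷ xs)  refl mono with mono 0 z<s
... | refl = refl ∷ signs-from-windows n s _ xs refl (λ i i<m → mono (suc i) (s<s i<m))
signs-from-windows n s _ (pr _ _ ∷ _) refl mono with () ← mono 0 z<s
signs-from-windows n s _ (st _ ∷ _)   refl mono with () ← mono 0 z<s

no-monochromatic-level-two : ∀ n s L {L'} → length L ≡ 2 * n + 1 → All (_∈ F 2 n) L →
  Γ 2 n L ≡ just L' → All (_≡ sg s) L' → ⊥
no-monochromatic-level-two n s L len mem eq signs =
  m+1+n≰m (2 * n) (begin
    2 * n + 1            ≡⟨ sym len ⟩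
    length L             ≡⟨ sym (length-map first L) ⟩
    length (map first L) ≤⟨ strictly-monotone-length s (Linked.map⁺ (Γ₂-ascends n s L eq signs))
                              (All.map⁺ (All.map (F₂-first-bounds n) mem)) ⟩
    2 * n                ∎)
  where open ≤-Reasoning

no-monochromatic-path : ∀ t n s L → 1 ≤ n → length L ≡ 2 * n + suc t →
  All (_∈ F (suc (suc t)) n) L → ¬ MonochromaticWindows (suc (suc t)) n s (2 * n) L
no-monochromatic-path zero n s L 1≤n len mem mono
  with Γ-monochromatic 0 n s (2 * n) L (≤-trans 1≤n (m≤n*m n 2)) len mono
... | L' , eq , len' , mono' = no-monochromatic-level-two n s L len mem eq
  (signs-from-windows n s (2 * n) L' (trans len' (+-identityʳ (2 * n))) mono')
no-monochromatic-path (suc t) n s L 1≤n len mem mono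
  with Γ-monochromatic (suc t) n s (2 * n) L (≤-trans 1≤n (m≤n*m n 2)) len mono
... | L' , eq , len' , mono' = no-monochromatic-path t n s L' 1≤n len' (Γ-∈ t n L eq mem) mono'

lemma3p1 : (n r : ℕ) → 1 ≤ n → 3 ≤ r →
    (As : List Obj) → length As ≡ 2 * n + r ∸ 1 →
    All (λ A → A ∈ F r n) As →
    Linked (λ A B → lt r n A B ≡ true) As →
    ¬ (Σ Sign λ s → (i : ℕ) → i < 2 * n → colour r n (take r (drop i As)) ≡ just s)
lemma3p1 n (suc zero)          _ (s≤s ())
lemma3p1 n (suc (suc zero))    _ (s≤s (s≤s ()))
lemma3p1 n (suc (suc (suc t))) 1≤n _ As len mem _ (s , mono) =
  no-monochromatic-path (suc t) n s As 1≤n (trans len (+-∸-assoc (2 * n) (s≤s z≤n))) mem mono
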